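{- For an integer $q\ge 2$, let $n_q$ denote the number of elements of $\mathcal{G}_q$. Then $n_q=\tfrac12(\phi(q)+s_q)$, where $\phi$ is Euler's totient function and $s_q$ is the cardinality of $S_q=\{p\in\mathbb{Z}: 1\le p<q,\ p^2\equiv-1\pmod q\}$.
   Context: For $q\ge2$: $I_q=\{p\in\mathbb{Z}: 1\le p<q,\ \gcd(p,q)=1\}$; $S_q$ as in the claim; for $p\in I_q$, $y_{p,q}$ is the unique element of $I_q$ with $p\,y_{p,q}\equiv-1\pmod q$; $C_q=\{p\in I_q: p\ne y_{p,q}\}$; $C_q^*=\{p\in C_q: p<y_{p,q}\}$; and $\mathcal{G}_q=\{p/q: p\in C_q^*\cup S_q\}$. -}

module Defs where

open import Data.Nat using (ℕ; zero; suc; _+_; _*_; _<_; _≤_; _≤?_; _<?_)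
open import Data.Nat.Divisibility using (_∣_; _∣?_)
open import Data.Nat.Coprimality using (Coprime; coprime?)
open import Data.List using (List; filter; length; upTo; find)
open import Data.Maybe using (Maybe; just; nothing)
open import Data.Product using (_×_)
open import Data.Sum using (_⊎_)
open import Relation.Nullary using (¬_; Dec; no)
open import Data.Empty using (⊥)
open import Relation.Nullary.Decidable using (_×-dec_; _⊎-dec_; ¬?)
open import Relation.Binary.PropositionalEquality using (_≡_)

φ : ℕ → ℕ
φ n = length (filter (λ k → coprime? (suc k) n) (upTo n))

-- candidate range 1 ≤ p < q  (upTo q = 0,…,q-1; 0 is excluded by the predicates below
-- since we require 1 ≤ p explicitly)
range : ℕ → List ℕ
range q = upTo q

InI : ℕ → ℕ → Set
InI q p = (1 ≤ p × p < q) × Coprime p q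

inI? : (q p : ℕ) → Dec (InI q p)
inI? q p = ((1 ≤? p) ×-dec (p <? q)) ×-dec coprime? p q

-- y_{p,q}: the (unique) element y of I_q with p*y ≡ -1 (mod q), i.e. q ∣ p*y + 1.
-- Found by search over 1 ≤ y < q; nothing if it does not exist (never for p ∈ I_q, q ≥ 2).
y : ℕ → ℕ → Maybe ℕ
y q p = find (λ z → inI? q z ×-dec (q ∣? (p * z + 1))) (range q)

-- p ∈ C_q^* : p ∈ C_q (p ∈ I_q, p ≠ y_{p,q}) and p < y_{p,q}.
-- If no y exists (impossible for p ∈ I_q), p is not in C_q^*.
InCstar : ℕ → ℕ → Set
InCstar q p with y q p
... | just z  = InI q p × (¬ (p ≡ z) × p < z)
... | nothing = ⊥

inCstar? : (q p : ℕ) → Dec (InCstar q p)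
inCstar? q p with y q p
... | just z  = inI? q p ×-dec (¬? (p Data.Nat.≟ z) ×-dec (p <? z))
... | nothing = no (λ ())

InS : ℕ → ℕ → Set
InS q p = (1 ≤ p × p < q) × (q ∣ p * p + 1)

inS? : (q p : ℕ) → Dec (InS q p)
inS? q p = ((1 ≤? p) ×-dec (p <? q)) ×-dec (q ∣? (p * p + 1))

s : ℕ → ℕ
s q = length (filter (inS? q) (range q))

-- n_q = |G_q|, G_q = { p/q : p ∈ C_q^* ∪ S_q }; since p ↦ p/q is injective for fixed q,
-- this is the number of p ∈ [1,q) in C_q^* ∪ S_q.
n : ℕ → ℕ
n q = length (filter (λ p → inCstar? q p ⊎-dec inS? q p) (range q))

-- The map p ↦ y_{p,q} = -p⁻¹ mod q is an involution of I_q whose fixed points form S_q.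
-- Hence I_q splits as C_q^* ⊎ y(C_q^*) ⊎ S_q, and since y permutes [0, q) (extended by the
-- identity off I_q) the two copies of C_q^* have the same size: φ(q) = 2|C_q^*| + s_q.
-- Finally C_q^* and S_q are disjoint, so n_q = |C_q^*| + s_q.
module Submission where

open import Defs
open import Data.Nat using (ℕ; zero; suc; _+_; _*_; _%_; _/_; _≤_; _<_; z≤n; s≤s; NonZero)
open import Data.Nat.Properties
open import Data.Nat.Divisibility
  using (_∣_; _∣?_; divides; ∣-refl; ∣-trans; ∣m+n∣m⇒∣n; m∣m*n; n∣m*n; >⇒∤; ∣1⇒≡1; _∣0)
open import Data.Nat.DivMod using (m≡m%n+[m/n]*n; m%n<n)
open import Data.Nat.Coprimality as Coprime using (Coprime; coprime?; coprime-divisor; coprime-Bézout)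
open import Data.Nat.GCD using (module Bézout)
open import Data.Nat.Tactic.RingSolver using (solve-∀)
open import Data.Fin using (Fin; toℕ; fromℕ; fromℕ<; inject₁)
open import Data.Fin.Properties
  using (toℕ-fromℕ; toℕ-fromℕ<; toℕ-inject₁; toℕ<n; toℕ-injective)
open import Data.Fin.Permutation using (permutation)
open import Data.List using (_∷_; find; filter; length; applyUpTo)
open import Data.List.Membership.Propositional using (_∈_)
open import Data.List.Membership.Propositional.Properties using (∈-upTo⁺)
open import Data.List.Relation.Unary.Any using (here; there)
open import Data.Maybe using (Maybe; just; nothing; fromMaybe)
open import Data.Maybe.Properties using (just-injective)
open import Data.Product using (_×_; _,_; proj₁; proj₂; ∃-syntax)
open import Data.Sum using (inj₁; inj₂)
open import Function using (_∘_; id)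
open import Relation.Binary.Definitions using (tri<; tri≈; tri>)
open import Relation.Binary.PropositionalEquality
open import Relation.Nullary using (Dec; yes; no; ¬_; contradiction)
open import Relation.Nullary.Decidable using (_×-dec_; _⊎-dec_)
open import Relation.Unary using (Pred; Decidable)
open import Algebra.Properties.CommutativeMonoid.Sum +-0-commutativeMonoid
  using (sum-syntax; sum-cong-≗; sum-init-last; sum-permute; ∑-distrib-+)

open ≡-Reasoning

∣*+1⇒coprime : ∀ {q a b} → q ∣ a * b + 1 → Coprime a q
∣*+1⇒coprime {b = b} q∣ab+1 (d∣a , d∣q) =
  ∣1⇒≡1 (∣m+n∣m⇒∣n (∣-trans d∣q q∣ab+1) (∣-trans d∣a (m∣m*n b)))

∣*+1-comm : ∀ {q a b} → q ∣ a * b + 1 → q ∣ b * a + 1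
∣*+1-comm {q} {a} {b} = subst (q ∣_) (cong (_+ 1) (*-comm a b))

∣∧<⇒≡0 : ∀ {q k} → q ∣ k → k < q → k ≡ 0
∣∧<⇒≡0 {k = zero}  _   _   = refl
∣∧<⇒≡0 {k = suc _} q∣k k<q = contradiction q∣k (>⇒∤ k<q)

inverse-unique-≤ : ∀ {q p a b} → Coprime p q → a ≤ b → b < q →
                   q ∣ p * a + 1 → q ∣ p * b + 1 → a ≡ b
inverse-unique-≤ {q} {p} {a} c a≤b b<q qa qb with m≤n⇒∃[o]m+o≡n a≤b
... | k , refl = sym (trans (cong (a +_) k≡0) (+-identityʳ a))
  where
  split : ∀ p a k → p * (a + k) + 1 ≡ (p * a + 1) + p * k
  split = solve-∀
  q∣pk : q ∣ p * k
  q∣pk = ∣m+n∣m⇒∣n (subst (q ∣_) (split p a k) qb) qa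
  k≡0 : k ≡ 0
  k≡0 = ∣∧<⇒≡0 (coprime-divisor (Coprime.sym c) q∣pk) (≤-<-trans (m≤n+m k a) b<q)

inverse-unique : ∀ {q p a b} → Coprime p q → a < q → b < q →
                 q ∣ p * a + 1 → q ∣ p * b + 1 → a ≡ b
inverse-unique c a<q b<q qa qb with ≤-total _ _
... | inj₁ a≤b = inverse-unique-≤ c a≤b b<q qa qb
... | inj₂ b≤a = sym (inverse-unique-≤ c b≤a a<q qb qa)

∣*+1-mod : ∀ {q p w} .{{_ : NonZero q}} → q ∣ p * w + 1 → q ∣ p * (w % q) + 1
∣*+1-mod {q} {p} {w} q∣pw+1 =
  ∣m+n∣m⇒∣n (subst (q ∣_) split q∣pw+1) (∣-trans (n∣m*n (w / q)) (n∣m*n p))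
  where
  regroup : ∀ p r t q → p * (r + t * q) + 1 ≡ p * (t * q) + (p * r + 1)
  regroup = solve-∀
  split : p * w + 1 ≡ p * ((w / q) * q) + (p * (w % q) + 1)
  split = trans (cong (λ t → p * t + 1) (m≡m%n+[m/n]*n w q)) (regroup p (w % q) (w / q) q)

coprime⇒∃inverse : ∀ {q p} .{{_ : NonZero q}} → Coprime p q → ∃[ w ] q ∣ p * w + 1
coprime⇒∃inverse {q@(suc r)} {p} c with coprime-Bézout c
... | Bézout.-+ x t eq =
  x , divides t (trans (+-comm (p * x) 1) (trans (cong suc (*-comm p x)) eq))
-- Here x p ≡ 1 + t q, so x p ≡ 1 and hence p (q - 1) x ≡ -1 modulo q.
... | Bézout.+- x t eq = r * x , divides (1 + r * t) (begin
  p * (r * x) + 1         ≡⟨ cong (_+ 1) (trans (*-comm p (r * x)) (*-assoc r x p)) ⟩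
  r * (x * p) + 1         ≡⟨ cong (λ v → r * v + 1) eq ⟨
  r * (1 + t * suc r) + 1 ≡⟨ expand r t ⟩
  (1 + r * t) * suc r     ∎)
  where
  expand : ∀ r t → r * (1 + t * suc r) + 1 ≡ (1 + r * t) * suc r
  expand = solve-∀

coprime⇒∃inverse< : ∀ {q p} .{{_ : NonZero q}} → Coprime p q → ∃[ z ] z < q × q ∣ p * z + 1
coprime⇒∃inverse< {q} {p} c with coprime⇒∃inverse c
... | w , q∣pw+1 = w % q , m%n<n w q , ∣*+1-mod {p = p} q∣pw+1

module _ {a p} {A : Set a} {P : Pred A p} (P? : Decidable P) where

  find-sound : ∀ xs {z} → find P? xs ≡ just z → P z
  find-sound (x ∷ xs) eq with P? x
  find-sound (x ∷ xs) refl | yes px = px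
  ... | no _ = find-sound xs eq

  find-unique : (∀ {u v} → P u → P v → u ≡ v) →
                ∀ {xs z} → z ∈ xs → P z → find P? xs ≡ just z
  find-unique unique {x ∷ xs} z∈ pz with P? x
  ... | yes px = cong just (unique px pz)
  find-unique unique {x ∷ xs} (here refl) pz | no ¬px = contradiction pz ¬px
  find-unique unique {x ∷ xs} (there z∈) pz | no _   = find-unique unique z∈ pz

inverse⇒InI : ∀ {q p z} → 2 ≤ q → z < q → q ∣ p * z + 1 → InI q z
inverse⇒InI {q} {p} {zero} 2≤q _ q∣p0+1 =
  contradiction (subst (q ∣_) (cong (_+ 1) (*-zeroʳ p)) q∣p0+1) (>⇒∤ 2≤q)
inverse⇒InI {q} {p} {suc _} _ z<q q∣pz+1 =
  (s≤s z≤n , z<q) , ∣*+1⇒coprime (∣*+1-comm {a = p} q∣pz+1)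

IsInverse : ℕ → ℕ → ℕ → Set
IsInverse q p z = InI q z × q ∣ p * z + 1

isInverse? : ∀ q p → Decidable (IsInverse q p)
isInverse? q p z = inI? q z ×-dec (q ∣? (p * z + 1))

y-sound : ∀ {q p z} → y q p ≡ just z → IsInverse q p z
y-sound {q} {p} = find-sound (isInverse? q p) (range q)

y-complete : ∀ {q p z} → Coprime p q → IsInverse q p z → y q p ≡ just z
y-complete {q} {p} c inv@(((_ , z<q) , _) , _) =
  find-unique (isInverse? q p) unique (∈-upTo⁺ z<q) inv
  where
  unique : ∀ {u v} → IsInverse q p u → IsInverse q p v → u ≡ v
  unique (((_ , u<q) , _) , qu) (((_ , v<q) , _) , qv) = inverse-unique c u<q v<q qu qv

y-total : ∀ {q p} → 2 ≤ q → InI q p → ∃[ z ] y q p ≡ just z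
y-total {q@(suc _)} {p} 2≤q (_ , c) with coprime⇒∃inverse< {q} {p} c
... | z , z<q , q∣pz+1 = z , y-complete c (inverse⇒InI {p = p} 2≤q z<q q∣pz+1 , q∣pz+1)

y-just⇒InI : ∀ {q p z} → 2 ≤ q → p < q → y q p ≡ just z → InI q p
y-just⇒InI {q} {p} {z} 2≤q p<q eq =
  inverse⇒InI {p = z} 2≤q p<q (∣*+1-comm {a = p} (proj₂ (y-sound {q} {p} eq)))

y-involutive : ∀ {q p z} → 2 ≤ q → p < q → y q p ≡ just z → y q z ≡ just p
y-involutive {q} {p} 2≤q p<q eq with y-sound {q} {p} eq
... | (_ , c) , q∣pz+1 = y-complete c (y-just⇒InI 2≤q p<q eq , ∣*+1-comm {a = p} q∣pz+1)

InS⇒y-fixed : ∀ {q p} → InS q p → y q p ≡ just p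
InS⇒y-fixed {q} {p} (bounds , q∣pp+1) = y-complete c ((bounds , c) , q∣pp+1)
  where
  c : Coprime p q
  c = ∣*+1⇒coprime q∣pp+1

y-fixed⇒InS : ∀ {q p} → y q p ≡ just p → InS q p
y-fixed⇒InS {q} {p} eq with y-sound {q} {p} eq
... | (bounds , _) , q∣pp+1 = bounds , q∣pp+1

InCstar-intro : ∀ {q p z} → InI q p → y q p ≡ just z → p < z → InCstar q p
InCstar-intro {q} {p} Ip eq p<z with y q p
InCstar-intro Ip refl p<z | just _ = Ip , <⇒≢ p<z , p<z

InCstar⇒< : ∀ {q p z} → y q p ≡ just z → InCstar q p → p < z
InCstar⇒< {q} {p} eq c with y q p
InCstar⇒< refl (_ , _ , p<z) | just _ = p<z

y-nothing⇒¬InCstar : ∀ {q p} → y q p ≡ nothing → ¬ InCstar q p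
y-nothing⇒¬InCstar {q} {p} eq c with y q p
y-nothing⇒¬InCstar refl () | nothing

InCstar⇒¬InS : ∀ {q p} → InCstar q p → ¬ InS q p
InCstar⇒¬InS {q} {p} c s = <-irrefl refl (InCstar⇒< {q} {p} (InS⇒y-fixed s) c)

σ : ℕ → ℕ → ℕ
σ q p = fromMaybe p (y q p)

σ-< : ∀ {q p} → p < q → σ q p < q
σ-< {q} {p} p<q with y q p in eq
... | just z  = proj₂ (proj₁ (proj₁ (y-sound {q} {p} eq)))
... | nothing = p<q

σ-involutive : ∀ {q p} → 2 ≤ q → p < q → σ q (σ q p) ≡ p
σ-involutive {q} {p} 2≤q p<q with y q p in eq
... | just z  = cong (fromMaybe z) (y-involutive 2≤q p<q eq)
... | nothing = cong (fromMaybe p) eq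

𝟙 : ∀ {a} {A : Set a} → Dec A → ℕ
𝟙 (yes _) = 1
𝟙 (no _)  = 0

𝟙-yes : ∀ {a} {A : Set a} (d : Dec A) → A → 𝟙 d ≡ 1
𝟙-yes (yes _) _ = refl
𝟙-yes (no ¬a) a = contradiction a ¬a

𝟙-no : ∀ {a} {A : Set a} (d : Dec A) → ¬ A → 𝟙 d ≡ 0
𝟙-no (yes a) ¬a = contradiction a ¬a
𝟙-no (no _)  _  = refl

𝟙-cong : ∀ {a b} {A : Set a} {B : Set b} (d : Dec A) (e : Dec B) →
         (A → B) → (B → A) → 𝟙 d ≡ 𝟙 e
𝟙-cong (yes a) e to _    = sym (𝟙-yes e (to a))
𝟙-cong (no ¬a) e _  from = sym (𝟙-no e (¬a ∘ from))

𝟙-⊎ : ∀ {a b} {A : Set a} {B : Set b} (d : Dec A) (e : Dec B) →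
      ¬ (A × B) → 𝟙 (d ⊎-dec e) ≡ 𝟙 d + 𝟙 e
𝟙-⊎ (yes a) (yes b) ¬ab = contradiction (a , b) ¬ab
𝟙-⊎ (yes _) (no _)  _   = refl
𝟙-⊎ (no _)  (yes _) _   = refl
𝟙-⊎ (no _)  (no _)  _   = refl

count : ∀ {p} {P : Pred ℕ p} → Decidable P → ℕ → ℕ
count P? n = ∑[ i < n ] 𝟙 (P? (toℕ i))

length-filter-applyUpTo : ∀ {p} {P : Pred ℕ p} (P? : Decidable P) f n →
                          length (filter P? (applyUpTo f n)) ≡ count (P? ∘ f) n
length-filter-applyUpTo P? f zero = refl
length-filter-applyUpTo P? f (suc n) with P? (f 0)
... | yes _ = cong suc (length-filter-applyUpTo P? (f ∘ suc) n)
... | no _  = length-filter-applyUpTo P? (f ∘ suc) n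

count-⊎ : ∀ {p r} {P : Pred ℕ p} {R : Pred ℕ r} (P? : Decidable P) (R? : Decidable R) n →
          (∀ k → ¬ (P k × R k)) → count (λ k → P? k ⊎-dec R? k) n ≡ count P? n + count R? n
count-⊎ P? R? n disjoint =
  trans (sum-cong-≗ {n} (λ i → 𝟙-⊎ (P? (toℕ i)) (R? (toℕ i)) (disjoint (toℕ i))))
        (∑-distrib-+ {n} _ _)

∑-involution : ∀ n (h : ℕ → ℕ) → (∀ {k} → k < n → h k < n) →
               (∀ {k} → k < n → h (h k) ≡ k) → (f : ℕ → ℕ)
               → ∑[ i < n ] f (toℕ i) ≡ ∑[ i < n ] f (h (toℕ i))
∑-involution n h h< h-involutive f = begin
  ∑[ i < n ] f (toℕ i)         ≡⟨ sum-permute (f ∘ toℕ) π ⟩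
  ∑[ i < n ] f (toℕ (hᶠ i))    ≡⟨ sum-cong-≗ (λ i → cong f (toℕ-fromℕ< (h< (toℕ<n i)))) ⟩
  ∑[ i < n ] f (h (toℕ i))     ∎
  where
  hᶠ : Fin n → Fin n
  hᶠ i = fromℕ< (h< (toℕ<n i))
  hᶠ-involutive : ∀ i → hᶠ (hᶠ i) ≡ i
  hᶠ-involutive i = toℕ-injective (begin
    toℕ (hᶠ (hᶠ i))   ≡⟨ toℕ-fromℕ< _ ⟩
    h (toℕ (hᶠ i))    ≡⟨ cong h (toℕ-fromℕ< _) ⟩
    h (h (toℕ i))     ≡⟨ h-involutive (toℕ<n i) ⟩
    toℕ i             ∎)
  π = permutation hᶠ hᶠ hᶠ-involutive hᶠ-involutive

𝟙-InI-partition : ∀ {q k} → 2 ≤ q → k < q →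
                  𝟙 (inI? q k) ≡ 𝟙 (inCstar? q k) + 𝟙 (inCstar? q (σ q k)) + 𝟙 (inS? q k)
𝟙-InI-partition {q} {k} 2≤q k<q = by-cases (y q k) refl
  where
  Partition : Maybe ℕ → Set
  Partition m =
    𝟙 (inI? q k) ≡ 𝟙 (inCstar? q k) + 𝟙 (inCstar? q (fromMaybe k m)) + 𝟙 (inS? q k)

  tally : ∀ {m i c c′ s} → 𝟙 (inI? q k) ≡ i → 𝟙 (inCstar? q k) ≡ c →
          𝟙 (inCstar? q (fromMaybe k m)) ≡ c′ → 𝟙 (inS? q k) ≡ s → i ≡ c + c′ + s →
          Partition m
  tally refl refl refl refl i≡c+c′+s = i≡c+c′+s

  InS⇒≡just-k : ∀ {m} → y q k ≡ m → InS q k → m ≡ just k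
  InS⇒≡just-k eq s = trans (sym eq) (InS⇒y-fixed s)

  by-cases : ∀ m → y q k ≡ m → Partition m
  by-cases nothing eq =
    tally {nothing} (𝟙-no _ ¬Ik) ¬Ck ¬Ck (𝟙-no _ (nothing≢just ∘ InS⇒≡just-k eq)) refl
    where
    nothing≢just : ∀ {j} → nothing ≢ just j
    nothing≢just ()
    ¬Ik : ¬ InI q k
    ¬Ik Ik = nothing≢just (trans (sym eq) (proj₂ (y-total 2≤q Ik)))
    ¬Ck : 𝟙 (inCstar? q k) ≡ 0
    ¬Ck = 𝟙-no _ (y-nothing⇒¬InCstar {q} {k} eq)
  by-cases (just z) eq with <-cmp k z
  ... | tri< k<z _ z≮k =
    tally {just z} (𝟙-yes _ Ik) (𝟙-yes _ (InCstar-intro Ik eq k<z))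
      (𝟙-no _ (z≮k ∘ InCstar⇒< {q} {z} (y-involutive 2≤q k<q eq)))
      (𝟙-no _ (<⇒≢ k<z ∘ sym ∘ just-injective ∘ InS⇒≡just-k eq)) refl
    where Ik = y-just⇒InI 2≤q k<q eq
  ... | tri≈ _ refl _ =
    tally {just z} (𝟙-yes _ Ik) (𝟙-no _ k≮k) (𝟙-no _ k≮k) (𝟙-yes _ (y-fixed⇒InS eq)) refl
    where
    Ik = y-just⇒InI 2≤q k<q eq
    k≮k = <-irrefl refl ∘ InCstar⇒< {q} {k} eq
  ... | tri> k≮z _ z<k =
    tally {just z} (𝟙-yes _ Ik) (𝟙-no _ (k≮z ∘ InCstar⇒< {q} {k} eq))
      (𝟙-yes _ (InCstar-intro Iz (y-involutive 2≤q k<q eq) z<k))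
      (𝟙-no _ (<⇒≢ z<k ∘ just-injective ∘ InS⇒≡just-k eq)) refl
    where
    Ik = y-just⇒InI 2≤q k<q eq
    Iz = proj₁ (y-sound {q} {k} eq)

-- φ counts 1 ≤ k ≤ q; for q ≥ 2 neither 0 nor q is coprime to q, so the window shifts to [0, q).
φ≡count-InI : ∀ {q} → 2 ≤ q → φ q ≡ count (inI? q) q
φ≡count-InI {q} 2≤q = begin
  φ q                              ≡⟨ length-filter-applyUpTo (λ k → coprime? (suc k) q) id q ⟩
  ∑[ i < q ] c (suc (toℕ i))       ≡⟨ cong (_+ ∑[ i < q ] c (suc (toℕ i))) c0≡0 ⟨
  ∑[ i < suc q ] c (toℕ i)         ≡⟨ sum-init-last {q} (c ∘ toℕ) ⟩
  ∑[ i < q ] c (toℕ (inject₁ i)) + c (toℕ (fromℕ q))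
    ≡⟨ cong₂ _+_ (sum-cong-≗ {q} (cong c ∘ toℕ-inject₁)) (trans (cong c (toℕ-fromℕ q)) cq≡0) ⟩
  ∑[ i < q ] c (toℕ i) + 0         ≡⟨ +-identityʳ _ ⟩
  ∑[ i < q ] c (toℕ i)             ≡⟨ sum-cong-≗ {q} (λ i → c≡𝟙InI (toℕ<n i)) ⟩
  count (inI? q) q                 ∎
  where
  c : ℕ → ℕ
  c k = 𝟙 (coprime? k q)
  q≢1 : q ≢ 1
  q≢1 refl = <-irrefl refl 2≤q
  c0≡0 : c 0 ≡ 0
  c0≡0 = 𝟙-no _ (λ cop → q≢1 (cop (q ∣0 , ∣-refl)))
  cq≡0 : c q ≡ 0
  cq≡0 = 𝟙-no _ (λ cop → q≢1 (cop (∣-refl , ∣-refl)))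
  c≡𝟙InI : ∀ {k} → k < q → c k ≡ 𝟙 (inI? q k)
  c≡𝟙InI {zero}  _   = trans c0≡0 (sym (𝟙-no (inI? q 0) λ { ((() , _) , _) }))
  c≡𝟙InI {suc k} k<q = 𝟙-cong _ _ (λ cop → (s≤s z≤n , k<q) , cop) proj₂

count-InI : ∀ {q} → 2 ≤ q →
            count (inI? q) q ≡ count (inCstar? q) q + count (inCstar? q) q + count (inS? q) q
count-InI {q} 2≤q = begin
  count (inI? q) q
    ≡⟨ sum-cong-≗ {q} (λ i → 𝟙-InI-partition 2≤q (toℕ<n i)) ⟩
  ∑[ i < q ] (C (toℕ i) + C (σ q (toℕ i)) + S (toℕ i))
    ≡⟨ ∑-distrib-+ {q} _ _ ⟩
  ∑[ i < q ] (C (toℕ i) + C (σ q (toℕ i))) + #S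
    ≡⟨ cong (_+ #S) (∑-distrib-+ {q} _ _) ⟩
  #C* + ∑[ i < q ] C (σ q (toℕ i)) + #S
    ≡⟨ cong (λ t → #C* + t + #S) (∑-involution q (σ q) σ-< (σ-involutive 2≤q) C) ⟨
  #C* + #C* + #S ∎
  where
  C S : ℕ → ℕ
  C k = 𝟙 (inCstar? q k)
  S k = 𝟙 (inS? q k)
  #C* #S : ℕ
  #C* = count (inCstar? q) q
  #S  = count (inS? q) q

n≡count : ∀ q → n q ≡ count (inCstar? q) q + count (inS? q) q
n≡count q = trans (length-filter-applyUpTo (λ p → inCstar? q p ⊎-dec inS? q p) id q)
                  (count-⊎ (inCstar? q) (inS? q) q (λ k (c , s) → InCstar⇒¬InS {q} {k} c s))

mainTheorem4 : (q : ℕ) → 2 ≤ q → 2 * n q ≡ φ q + s q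
mainTheorem4 q 2≤q = begin
  2 * n q                ≡⟨ cong (2 *_) (n≡count q) ⟩
  2 * (#C* + #S)         ≡⟨ double #C* #S ⟩
  #C* + #C* + #S + #S    ≡⟨ cong (_+ #S) (count-InI 2≤q) ⟨
  count (inI? q) q + #S  ≡⟨ cong₂ _+_ (φ≡count-InI 2≤q) (length-filter-applyUpTo (inS? q) id q) ⟨
  φ q + s q              ∎
  where
  #C* #S : ℕ
  #C* = count (inCstar? q) q
  #S  = count (inS? q) q
  double : ∀ c s → 2 * (c + s) ≡ c + c + s + s
  double = solve-∀
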